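{- For a relation $Q \subseteq X \times Y$ between Kripke frames $(X,R)$ and $(Y,S)$, the following are equivalent: (i) $Q$ is a cosimulation; (ii) $B \mathrel{\mathrm{Low}(Q)^{\circ}} A$ implies $\Diamond^{ - } B \mathrel{\mathrm{Low}(Q)^{\circ}} \Diamond^{ - } A$ for all $B \subseteq Y$, $A \subseteq X$; (iii) $B \mathrel{\mathrm{Low}(Q)^{\circ}} \Box A$ implies $\Diamond^{ - } B \mathrel{\mathrm{Low}(Q)^{\circ}} A$ for all $B \subseteq Y$, $A \subseteq X$.
   Context: $Q$ is a cosimulation if its converse $Q^\dagger \subseteq Y \times X$ is a simulation, i.e.\ $x \mathrel{Q} y$ and $y \mathrel{S} y'$ imply there is $x'$ with $x \mathrel{R} x'$ and $x' \mathrel{Q} y'$. $\mathrm{Low}(Q)$ is defined by $A \mathrel{\mathrm{Low}(Q)} B$ iff $\forall a\in A.\ \exists b \in B.\ a \mathrel{Q} b$. For a relation $P \subseteq \mathcal{B}\times\mathcal{B}'$ between complete atomic Boolean algebras, its variant $P^{\circ} \subseteq \mathcal{B}'\times\mathcal{B}$ is: $b' \mathrel{P^{\circ}} b$ iff for every atom $a' \sqsubseteq b'$ there is an atom $a \sqsubseteq b$ with $a \mathrel{P} a'$ (so $B \mathrel{\mathrm{Low}(Q)^{\circ}} A$ iff $\forall b \in B.\ \exists a \in A.\ a \mathrel{Q} b$). On $\mathcal{P}(X)$, $\Diamond^{ - }(A) = \{w \mid \exists v\in A.\ v \mathrel{R} w\}$ and $\Box(A)=\{w \mid \forall v.\ w\mathrel{R}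 v \Rightarrow v\in A\}$; similarly on $\mathcal{P}(Y)$ with $S$. -}

module Defs where

open import Level using (Level; _⊔_; suc)
open import Data.Product using (Σ; _×_; _,_; ∃)
open import Relation.Unary using (Pred; _∈_)
open import Relation.Binary using (REL; Rel)

IsSimulation : ∀ {a b r s q} {X : Set a} {Y : Set b} →
  Rel X r → Rel Y s → REL X Y q → Set (a ⊔ b ⊔ r ⊔ s ⊔ q)
IsSimulation {Y = Y} R S Q =
  ∀ {x y x'} → Q x y → R x x' → Σ Y λ y' → S y y' × Q x' y'

_† : ∀ {a b q} {X : Set a} {Y : Set b} → REL X Y q → REL Y X q
(Q †) y x = Q x y

IsCosimulation : ∀ {a b r s q} {X : Set a} {Y : Set b} →
  Rel X r → Rel Y s → REL X Y q → Set (a ⊔ b ⊔ r ⊔ s ⊔ q)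
IsCosimulation R S Q = IsSimulation S R (Q †)

-- Low(Q)∘ : B Low(Q)∘ A iff ∀ b ∈ B. ∃ a ∈ A. a Q b
-- (atoms of the powerset algebra are singletons)
LowQ∘ : ∀ {a b q ℓ} {X : Set a} {Y : Set b} → REL X Y q →
  Pred Y ℓ → Pred X ℓ → Set (a ⊔ b ⊔ q ⊔ ℓ)
LowQ∘ {X = X} Q B A = ∀ {y} → y ∈ B → Σ X λ x → x ∈ A × Q x y

◇⁻ : ∀ {a r ℓ} {X : Set a} → Rel X r → Pred X ℓ → Pred X (a ⊔ r ⊔ ℓ)
◇⁻ {X = X} R A w = Σ X λ v → v ∈ A × R v w

□ : ∀ {a r ℓ} {X : Set a} → Rel X r → Pred X ℓ → Pred X (a ⊔ r ⊔ ℓ)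
□ {X = X} R A w = ∀ {v} → R w v → v ∈ A

{-# OPTIONS --safe #-}
module Submission where

open import Defs
open import Level using (Level; _⊔_; Lift; lift)
open import Data.Product using (_×_; _,_)
open import Function.Base using (_∘_)
open import Function.Bundles using (_⇔_; mk⇔)
open import Relation.Unary using (Pred; _⊆_; ｛_｝)
open import Relation.Binary using (REL; Rel)
open import Relation.Binary.PropositionalEquality using (refl)

-- (i) gives (ii) by transporting each S-step back along Q; (ii) gives (iii) because ◇⁻ is left
-- adjoint to □, so ◇⁻ (□ A) ⊆ A; and (iii) gives back (i) by testing it on B = {y} and on the
-- set A of R-successors of x, for which x ∈ □ A.

LowQ∘-monoʳ : ∀ {a b q ℓ} {X : Set a} {Y : Set b} {Q : REL X Y q}
  {B : Pred Y ℓ} {A A′ : Pred X ℓ} → A ⊆ A′ → LowQ∘ Q B A → LowQ∘ Q B A′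
LowQ∘-monoʳ A⊆A′ B≤A y∈B = let x , x∈A , xQy = B≤A y∈B in x , A⊆A′ x∈A , xQy

◇⁻□⊆ : ∀ {a r ℓ} {X : Set a} (R : Rel X r) {A : Pred X ℓ} → ◇⁻ R (□ R A) ⊆ A
◇⁻□⊆ R (v , v∈□A , vRw) = v∈□A vRw

module _ {a b r s q} {X : Set a} {Y : Set b}
         (R : Rel X r) (S : Rel Y s) (Q : REL X Y q) where

  private
    ℓ : Level
    ℓ = a ⊔ b ⊔ r ⊔ s

  ◇⁻-PreservesLowQ∘ : Set _
  ◇⁻-PreservesLowQ∘ = ∀ (B : Pred Y ℓ) (A : Pred X ℓ) →
    LowQ∘ Q B A → LowQ∘ Q (◇⁻ S B) (◇⁻ R A)

  ◇⁻-□-TransposesLowQ∘ : Set _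
  ◇⁻-□-TransposesLowQ∘ = ∀ (B : Pred Y ℓ) (A : Pred X ℓ) →
    LowQ∘ Q B (□ R A) → LowQ∘ Q (◇⁻ S B) A

  cosimulation⇒◇⁻-PreservesLowQ∘ : IsCosimulation R S Q → ◇⁻-PreservesLowQ∘
  cosimulation⇒◇⁻-PreservesLowQ∘ cosim B A B≤A (y , y∈B , ySy′) =
    let x , x∈A , xQy = B≤A y∈B
        x′ , xRx′ , x′Qy′ = cosim xQy ySy′
    in x′ , (x , x∈A , xRx′) , x′Qy′

  ◇⁻-PreservesLowQ∘⇒◇⁻-□-TransposesLowQ∘ :
    ◇⁻-PreservesLowQ∘ → ◇⁻-□-TransposesLowQ∘
  ◇⁻-PreservesLowQ∘⇒◇⁻-□-TransposesLowQ∘ preserve B A =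
    LowQ∘-monoʳ (◇⁻□⊆ R) ∘ preserve B (□ R A)

  ◇⁻-□-TransposesLowQ∘⇒cosimulation : ◇⁻-□-TransposesLowQ∘ → IsCosimulation R S Q
  ◇⁻-□-TransposesLowQ∘⇒cosimulation transpose {y} {x} xQy ySy′ =
    let x′ , lift xRx′ , x′Qy′ = transpose B A B≤□A (y , lift refl , ySy′)
    in x′ , xRx′ , x′Qy′
    where
    B : Pred Y ℓ
    B = Lift ℓ ∘ ｛ y ｝

    A : Pred X ℓ
    A = Lift ℓ ∘ R x

    B≤□A : LowQ∘ Q B (□ R A)
    B≤□A (lift refl) = x , lift , xQy

mainTheorem14 : ∀ {a b r s q} {X : Set a} {Y : Set b}
    (R : Rel X r) (S : Rel Y s) (Q : REL X Y q) →
    let ℓ = a ⊔ b ⊔ r ⊔ s in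
    (IsCosimulation R S Q ⇔
      (∀ (B : Pred Y ℓ) (A : Pred X ℓ) →
        LowQ∘ Q B A → LowQ∘ Q (◇⁻ S B) (◇⁻ R A)))
    ×
    (IsCosimulation R S Q ⇔
      (∀ (B : Pred Y ℓ) (A : Pred X ℓ) →
        LowQ∘ Q B (□ R A) → LowQ∘ Q (◇⁻ S B) A))
mainTheorem14 R S Q =
  mk⇔ (cosimulation⇒◇⁻-PreservesLowQ∘ R S Q)
      (◇⁻-□-TransposesLowQ∘⇒cosimulation R S Q ∘ ◇⁻-PreservesLowQ∘⇒◇⁻-□-TransposesLowQ∘ R S Q)
  ,
  mk⇔ (◇⁻-PreservesLowQ∘⇒◇⁻-□-TransposesLowQ∘ R S Q ∘ cosimulation⇒◇⁻-PreservesLowQ∘ R S Q)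
      (◇⁻-□-TransposesLowQ∘⇒cosimulation R S Q)
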